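{- Let $k\ge 1$ be an integer, let $\Gamma$ be an abelian group, let $A_1,\dots,A_k,B$ be finite subsets of $\Gamma$, let $W,Y\subseteq\Gamma^k$ and $X,Z\subseteq\Gamma$ be finite. Then $$|W\times X|\,|Y-\Delta(Z)| \le |Y\times W\times Z-\Delta(X)|,$$ $$|A_1\times\dots\times A_k-\Delta(B)| \le |A_1\times\dots\times A_m-\Delta(A_{m+1})|\,|A_{m+1}\times\dots\times A_k-\Delta(B)| \quad\text{for every } m\in\{1,\dots,k-1\},$$ and $$|Y\times Z-\Delta(X)| = |Y\times X-\Delta(Z)|.$$
   Context: For a positive integer $n$ and $T\subseteq\Gamma$, $\Delta(T)=\Delta_n(T)=\{(t,\dots,t)\in\Gamma^n: t\in T\}$, where $n$ is the dimension of the ambient product. For $S\subseteq\Gamma^n$ and $T\subseteq\Gamma$, $S-\Delta(T)=\{(s_1-t,\dots,s_n-t): (s_1,\dots,s_n)\in S,\ t\in T\}\subseteq\Gamma^n$. Products such as $Y\times W\times Z$ are regarded as subsets of $\Gamma^{2k+1}$, and $Y\times Z$, $Y\times X$ as subsets of $\Gamma^{k+1}$. -}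

module Defs where

open import Level using (Level; _⊔_)
open import Algebra.Bundles using (AbelianGroup)
open import Data.Nat using (ℕ; _+_)
open import Data.Product using (Σ; ∃; ∃-syntax; _×_; _,_)
open import Data.List using (List; length)
open import Data.Vec using (Vec; []; _∷_; _++_; map)
open import Relation.Unary using (Pred)
open import Relation.Binary.PropositionalEquality using (_≡_)
import Data.Vec.Relation.Binary.Pointwise.Inductive as PW
import Data.List.Relation.Unary.Unique.Setoid as UniqueS
import Data.List.Membership.Setoid as MemS

module _ {c ℓ : Level} (G : AbelianGroup c ℓ) where
  open AbelianGroup G

  _⊖_ : Carrier → Carrier → Carrier
  a ⊖ b = a ∙ (b ⁻¹)

  VecSetoid : ℕ → _
  VecSetoid n = PW.setoid setoid n

  _≋_ : {n : ℕ} → Vec Carrier n → Vec Carrier n → Set (c ⊔ ℓ)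
  _≋_ = PW.Pointwise _≈_

  FinSub : Set (c ⊔ ℓ)
  FinSub = Σ (List Carrier) (UniqueS.Unique setoid)

  FinSubⁿ : ℕ → Set (c ⊔ ℓ)
  FinSubⁿ n = Σ (List (Vec Carrier n)) (UniqueS.Unique (VecSetoid n))

  ∣_∣ : FinSub → ℕ
  ∣ (L , _) ∣ = length L

  ∣_∣ⁿ : {n : ℕ} → FinSubⁿ n → ℕ
  ∣ (L , _) ∣ⁿ = length L

  _∈₁_ : Carrier → FinSub → Set (c ⊔ ℓ)
  x ∈₁ (L , _) = MemS._∈_ setoid x L

  _∈ⁿ_ : {n : ℕ} → Vec Carrier n → FinSubⁿ n → Set (c ⊔ ℓ)
  _∈ⁿ_ {n} v (L , _) = MemS._∈_ (VecSetoid n) v L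

  -- Δ(t) = (t,…,t) subtracted from a tuple: (s₁ - t, …, sₙ - t)
  shift : {n : ℕ} → Vec Carrier n → Carrier → Vec Carrier n
  shift s t = map (λ x → x ⊖ t) s

  _−Δ_ : {n : ℕ} → Pred (Vec Carrier n) (c ⊔ ℓ) → FinSub → Pred (Vec Carrier n) (c ⊔ ℓ)
  (S −Δ T) v = ∃[ s ] ∃[ t ] (S s × t ∈₁ T × v ≋ shift s t)

  ⟦_⟧ⁿ : {n : ℕ} → FinSubⁿ n → Pred (Vec Carrier n) (c ⊔ ℓ)
  ⟦ W ⟧ⁿ v = v ∈ⁿ W

  _×₁_ : {n : ℕ} → FinSubⁿ n → FinSub → Pred (Vec Carrier (n + 1)) (c ⊔ ℓ)
  (Y ×₁ Z) v = ∃[ y ] ∃[ z ] (y ∈ⁿ Y × z ∈₁ Z × v ≋ (y ++ (z ∷ [])))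

  _×ⁿ_×₁_ : {n m : ℕ} → FinSubⁿ n → FinSubⁿ m → FinSub → Pred (Vec Carrier (n + (m + 1))) (c ⊔ ℓ)
  (Y ×ⁿ W ×₁ Z) v = ∃[ y ] ∃[ w ] ∃[ z ] (y ∈ⁿ Y × w ∈ⁿ W × z ∈₁ Z × v ≋ (y ++ (w ++ (z ∷ []))))

  Prod : {n : ℕ} → Vec FinSub n → Pred (Vec Carrier n) (c ⊔ ℓ)
  Prod As v = PW.Pointwise _∈₁_ v As

  HasCard : {n : ℕ} → Pred (Vec Carrier n) (c ⊔ ℓ) → ℕ → Set (c ⊔ ℓ)
  HasCard {n} P N =
    ∃[ L ] (UniqueS.Unique (VecSetoid n) L
           × (∀ v → P v → MemS._∈_ (VecSetoid n) v L)
           × (∀ v → MemS._∈_ (VecSetoid n) v L → P v)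
           × length L ≡ N)

-- All three statements are counting arguments by explicit injections.  For the first,
-- fix for every v ∈ Y − Δ(Z) a representation v = y − z; then
-- (w, x, v) ↦ (y − x, w − x, z − x) embeds W × X × (Y − Δ(Z)) into Y × W × Z − Δ(X),
-- because (y − x) − (z − x) = v recovers v, hence (y, z), and then z − x recovers x.
-- For the second, s − t ↦ ((s₁,…,sₘ) − s_{m+1}, (s_{m+1},…,s_k) − t) is injective,
-- since the coordinate s_{m+1} − t is kept.  For the third, (y, z) − x ↦ (y, x) − z is
-- the map (p, q) ↦ (p − q, −q) on Γ^(k+1), hence injective, and the situation is
-- symmetric in X and Z.
module Submission where

open import Defs
open import Level using (Level; _⊔_)
open import Algebra.Bundles using (AbelianGroup)
open import Data.Nat using (ℕ; suc; _+_; _*_; _≤_)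
open import Data.Product using (_×_)
open import Data.Vec using (Vec; _∷_; _++_)
open import Relation.Binary.PropositionalEquality using (_≡_)

import Algebra.Properties.Group as GroupProperties
open import Data.Empty using (⊥-elim)
open import Data.Fin using (Fin; zero; suc)
open import Data.Fin.Properties using (injective⇒≤)
open import Data.List as List using (List; []; _∷_; length; lookup; allFin; cartesianProduct; cartesianProductWith)
open import Data.List.Properties using (length-++; length-map; length-tabulate)
import Data.List.Membership.Propositional.Properties as Membershipₚ
import Data.List.Membership.Setoid as Membership
open import Data.List.Membership.Setoid.Properties
  using (∈-lookup; index-injective; ∈-resp-≈; ∈-cartesianProduct⁻; ∈-cartesianProductWith⁺)
import Data.List.Relation.Unary.All as All
open import Data.List.Relation.Unary.AllPairs using (_∷_)
open import Data.List.Relation.Unary.Any using (index)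
open import Data.List.Relation.Unary.Unique.Setoid using (Unique)
open import Data.List.Relation.Unary.Unique.Setoid.Properties using (cartesianProduct⁺)
open import Data.List.Relation.Unary.Unique.Propositional.Properties using (allFin⁺)
open import Data.Nat.Properties using (≤-antisym)
open import Data.Product using (_,_; proj₁; proj₂; ∃₂)
open import Data.Product.Relation.Binary.Pointwise.NonDependent using (_×ₛ_)
open import Data.Vec using ([]; splitAt)
open import Data.Vec.Properties using (map-++)
open import Data.Vec.Relation.Binary.Pointwise.Inductive as Pointwise using ([]; _∷_)
open import Function.Definitions using (Injective)
open import Relation.Binary.Bundles using (Setoid)
open import Relation.Unary using (Pred)
open import Relation.Binary.PropositionalEquality as ≡ using (refl; cong; cong₂; subst; subst₂)

module _ {a ℓ : Level} (S : Setoid a ℓ) where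
  open Setoid S using (_≈_; sym)

  lookup-injective : ∀ {xs} → Unique S xs → ∀ i j → lookup xs i ≈ lookup xs j → i ≡ j
  lookup-injective {_ ∷ _}  _          zero    zero    _ = refl
  lookup-injective {_ ∷ xs} (x∉xs ∷ _) zero    (suc j) e = ⊥-elim (All.lookup x∉xs (Membershipₚ.∈-lookup {xs = xs} j) e)
  lookup-injective {_ ∷ xs} (x∉xs ∷ _) (suc i) zero    e = ⊥-elim (All.lookup x∉xs (Membershipₚ.∈-lookup {xs = xs} i) (sym e))
  lookup-injective          (_ ∷ xs!)  (suc i) (suc j) e = cong suc (lookup-injective xs! i j e)

module _ {a₁ ℓ₁ a₂ ℓ₂ : Level} (S : Setoid a₁ ℓ₁) (T : Setoid a₂ ℓ₂) where
  private
    module S = Setoid S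
    module T = Setoid T
  open Membership S renaming (_∈_ to _∈ₛ_)
  open Membership T renaming (_∈_ to _∈ₜ_)

  injection⇒length≤ : ∀ {xs ys} (f : S.Carrier → T.Carrier) → (∀ {x y} → f x T.≈ f y → x S.≈ y) →
                      Unique S xs → (∀ {x} → x ∈ₛ xs → f x ∈ₜ ys) → length xs ≤ length ys
  injection⇒length≤ {xs} f f-injective xs! f∈ys = injective⇒≤ position-injective
    where
    position : Fin (length xs) → Fin _
    position i = index (f∈ys (∈-lookup S xs i))

    position-injective : Injective _≡_ _≡_ position
    position-injective {i} {j} eq =
      lookup-injective S xs! i j (f-injective (index-injective T (f∈ys _) (f∈ys _) eq))

length-cartesianProductWith : ∀ {a b c} {A : Set a} {B : Set b} {C : Set c} (f : A → B → C) xs ys →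
                              length (cartesianProductWith f xs ys) ≡ length xs * length ys
length-cartesianProductWith f []       ys = refl
length-cartesianProductWith f (x ∷ xs) ys = ≡.trans (length-++ (List.map (f x) ys))
  (cong₂ _+_ (length-map (f x) ys) (length-cartesianProductWith f xs ys))

data SplitAt {a} {A : Set a} (m : ℕ) {n : ℕ} : Vec A (m + n) → Set a where
  _++ˢ_ : (p : Vec A m) (q : Vec A n) → SplitAt m (p ++ q)

splitAtView : ∀ {a} {A : Set a} m {n} (v : Vec A (m + n)) → SplitAt m v
splitAtView m v with splitAt m v
... | p , q , refl = p ++ˢ q

module _ {c ℓ : Level} (G : AbelianGroup c ℓ) where
  open AbelianGroup G renaming (refl to ≈-refl)
  open GroupProperties group using (∙-cancelˡ; ∙-cancelʳ; ⁻¹-injective; ⁻¹-anti-homo-//; //-rightDividesˡ)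
  open import Relation.Binary.Reasoning.Setoid setoid
  open module Vecₛ {n} = Setoid (VecSetoid G n) using ()
    renaming (_≈_ to _≈ᵛ_; refl to ≈ᵛ-refl; sym to ≈ᵛ-sym; trans to ≈ᵛ-trans; reflexive to ≈ᵛ-reflexive)

  -‿cancelʳ : ∀ {x y z} → x - z ≈ y - z → x ≈ y
  -‿cancelʳ {x} {y} {z} = ∙-cancelʳ (z ⁻¹) x y

  -‿cancelˡ : ∀ {x y z} → x - y ≈ x - z → y ≈ z
  -‿cancelˡ {x} e = ⁻¹-injective (∙-cancelˡ x _ _ e)

  x-z-[y-z]≈x-y : ∀ x y z → (x - z) - (y - z) ≈ x - y
  x-z-[y-z]≈x-y x y z = begin
    (x - z) - (y - z)        ≈⟨ ∙-congˡ (⁻¹-anti-homo-// y z) ⟩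
    (x - z) ∙ (z - y)        ≈⟨ assoc (x - z) z (y ⁻¹) ⟨
    ((x - z) ∙ z) ∙ y ⁻¹     ≈⟨ ∙-congʳ (//-rightDividesˡ z x) ⟩
    x - y                    ∎

  shift-cong : ∀ {n} {p q : Vec Carrier n} {x y} → p ≈ᵛ q → x ≈ y → shift G p x ≈ᵛ shift G q y
  shift-cong []         _   = []
  shift-cong (e ∷ p≈q) x≈y = ∙-cong e (⁻¹-cong x≈y) ∷ shift-cong p≈q x≈y

  shift-injective : ∀ {n} {p q : Vec Carrier n} {x} → shift G p x ≈ᵛ shift G q x → p ≈ᵛ q
  shift-injective {p = []}    {[]}    []        = []
  shift-injective {p = _ ∷ _} {_ ∷ _} (e ∷ es) = -‿cancelʳ e ∷ shift-injective es

  shift-shift : ∀ {n} (p : Vec Carrier n) x y → shift G (shift G p x) (y - x) ≈ᵛ shift G p y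
  shift-shift []      x y = []
  shift-shift (a ∷ p) x y = x-z-[y-z]≈x-y a y x ∷ shift-shift p x y

  shift-++⁻ : ∀ {m n} (p p' : Vec Carrier m) {q q' : Vec Carrier n} {x x'} →
              shift G (p ++ q) x ≈ᵛ shift G (p' ++ q') x' →
              shift G p x ≈ᵛ shift G p' x' × shift G q x ≈ᵛ shift G q' x'
  shift-++⁻ p p' {q} {q'} {x} {x'} e = Pointwise.++⁻ (shift G p x) (shift G p' x')
    (subst₂ _≈ᵛ_ (map-++ (_- x) p q) (map-++ (_- x') p' q') e)

  HasCard-injection⇒≤ : ∀ {n m} {P : Pred (Vec Carrier n) (c ⊔ ℓ)} {Q : Pred (Vec Carrier m) (c ⊔ ℓ)} {a b}
                        (f : Vec Carrier n → Vec Carrier m) → (∀ {u v} → f u ≈ᵛ f v → u ≈ᵛ v) →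
                        (∀ {v} → P v → Q (f v)) → HasCard G P a → HasCard G Q b → a ≤ b
  HasCard-injection⇒≤ f f-injective f-maps (L , L! , _ , L⊆P , refl) (M , _ , Q⊆M , _ , refl) =
    injection⇒length≤ (VecSetoid G _) (VecSetoid G _) f f-injective L! (λ v∈L → Q⊆M _ (f-maps (L⊆P _ v∈L)))

  module _ {k : ℕ} where

    reflectLast : Vec Carrier (k + 1) → Vec Carrier (k + 1)
    reflectLast v with splitAtView k v
    ... | p ++ˢ (x ∷ []) = shift G p x ++ (x ⁻¹ ∷ [])

    reflectLast-injective : ∀ {u v} → reflectLast u ≈ᵛ reflectLast v → u ≈ᵛ v
    reflectLast-injective {u} {v} e with splitAtView k u | splitAtView k v
    ... | p ++ˢ (x ∷ []) | q ++ˢ (y ∷ []) with Pointwise.++⁻ (shift G p x) (shift G q y) e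
    ... | p-x≈q-y , (x⁻¹≈y⁻¹ ∷ []) =
      Pointwise.++⁺ (shift-injective (≈ᵛ-trans p-x≈q-y (shift-cong ≈ᵛ-refl (sym x≈y)))) (x≈y ∷ [])
      where x≈y = ⁻¹-injective x⁻¹≈y⁻¹

    reflectLast-maps : (Y : FinSubⁿ G k) (X Z : FinSub G) →
                       ∀ {v} → _−Δ_ G (_×₁_ G Y Z) X v → _−Δ_ G (_×₁_ G Y X) Z (reflectLast v)
    reflectLast-maps Y X Z {v} (s , t , (y , z , y∈Y , z∈Z , s≈y++z) , t∈X , v≈s-t) with splitAtView k v
    ... | p ++ˢ (x ∷ [])
      with Pointwise.++⁻ p (shift G y t)
             (≈ᵛ-trans v≈s-t (≈ᵛ-trans (shift-cong s≈y++z ≈-refl) (≈ᵛ-reflexive (map-++ (_- t) y (z ∷ [])))))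
    ... | p≈y-t , (x≈z-t ∷ []) = y ++ (t ∷ []) , z , (y , t , y∈Y , t∈X , ≈ᵛ-refl) , z∈Z ,
      ≈ᵛ-trans (Pointwise.++⁺ (≈ᵛ-trans (shift-cong p≈y-t x≈z-t) (shift-shift y t z))
                              (trans (⁻¹-cong x≈z-t) (⁻¹-anti-homo-// z t) ∷ []))
               (≈ᵛ-reflexive (≡.sym (map-++ (_- z) y (t ∷ []))))

    ∣Y×Z−ΔX∣≤∣Y×X−ΔZ∣ : (Y : FinSubⁿ G k) (X Z : FinSub G) {a b : ℕ} →
                        HasCard G (_−Δ_ G (_×₁_ G Y Z) X) a → HasCard G (_−Δ_ G (_×₁_ G Y X) Z) b → a ≤ b
    ∣Y×Z−ΔX∣≤∣Y×X−ΔZ∣ Y X Z = HasCard-injection⇒≤ reflectLast reflectLast-injective (reflectLast-maps Y X Z)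

  module _ {m n : ℕ} where

    shiftPrefix : Vec Carrier (m + suc n) → Vec Carrier (m + suc n)
    shiftPrefix v with splitAtView m v
    ... | p ++ˢ (x ∷ q) = shift G p x ++ (x ∷ q)

    shiftPrefix-injective : ∀ {u v} → shiftPrefix u ≈ᵛ shiftPrefix v → u ≈ᵛ v
    shiftPrefix-injective {u} {v} e with splitAtView m u | splitAtView m v
    ... | p ++ˢ (x ∷ q) | p' ++ˢ (x' ∷ q') with Pointwise.++⁻ (shift G p x) (shift G p' x') e
    ... | p-x≈p'-x' , (x≈x' ∷ q≈q') =
      Pointwise.++⁺ (shift-injective (≈ᵛ-trans p-x≈p'-x' (shift-cong ≈ᵛ-refl (sym x≈x')))) (x≈x' ∷ q≈q')

    shiftPrefix-splits : (As : Vec (FinSub G) m) (C : FinSub G) (Cs : Vec (FinSub G) n) (B : FinSub G) →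
                         ∀ {v} → _−Δ_ G (Prod G (As ++ (C ∷ Cs))) B v →
                         ∃₂ λ u w → shiftPrefix v ≡ u ++ w × _−Δ_ G (Prod G As) C u × _−Δ_ G (Prod G (C ∷ Cs)) B w
    shiftPrefix-splits As C Cs B {v} (s , t , s∈ΠA , t∈B , v≈s-t) with splitAtView m v | splitAtView m s
    ... | p ++ˢ (x ∷ q) | s₁ ++ˢ (c ∷ s₂)
      with Pointwise.++⁻ s₁ As s∈ΠA
         | Pointwise.++⁻ p (shift G s₁ t) (≈ᵛ-trans v≈s-t (≈ᵛ-reflexive (map-++ (_- t) s₁ (c ∷ s₂))))
    ... | s₁∈ΠAs , (c∈C ∷ s₂∈ΠCs) | p≈s₁-t , (x≈c-t ∷ q≈s₂-t) =
      shift G p x , x ∷ q , refl ,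
      (s₁ , c , s₁∈ΠAs , c∈C , ≈ᵛ-trans (shift-cong p≈s₁-t x≈c-t) (shift-shift s₁ t c)) ,
      (c ∷ s₂ , t , c∈C ∷ s₂∈ΠCs , t∈B , x≈c-t ∷ q≈s₂-t)

    ∣ΠA−ΔB∣≤∣ΠAs−ΔC∣∣ΠCs−ΔB∣ : (As : Vec (FinSub G) m) (C : FinSub G) (Cs : Vec (FinSub G) n) (B : FinSub G)
                              {a b d : ℕ} →
                              HasCard G (_−Δ_ G (Prod G (As ++ (C ∷ Cs))) B) a →
                              HasCard G (_−Δ_ G (Prod G As) C) b →
                              HasCard G (_−Δ_ G (Prod G (C ∷ Cs)) B) d → a ≤ b * d
    ∣ΠA−ΔB∣≤∣ΠAs−ΔC∣∣ΠCs−ΔB∣ As C Cs B (L , L! , _ , L⊆ , refl) (M , _ , ⊆M , _ , refl) (N , _ , ⊆N , _ , refl) =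
      subst (length L ≤_) (length-cartesianProductWith _++_ M N)
        (injection⇒length≤ (VecSetoid G _) (VecSetoid G _) shiftPrefix shiftPrefix-injective L! image∈M×N)
      where
      image∈M×N : ∀ {v} → Membership._∈_ (VecSetoid G _) v L →
                  Membership._∈_ (VecSetoid G _) (shiftPrefix v) (cartesianProductWith _++_ M N)
      image∈M×N v∈L with shiftPrefix-splits As C Cs B (L⊆ _ v∈L)
      ... | u , w , eq , u∈ , w∈ = ∈-resp-≈ (VecSetoid G _) (≈ᵛ-reflexive (≡.sym eq))
        (∈-cartesianProductWith⁺ (VecSetoid G m) (VecSetoid G (suc n)) (VecSetoid G _) Pointwise.++⁺ (⊆M _ u∈) (⊆N _ w∈))

  ∣W×X∣∣Y−ΔZ∣≤∣Y×W×Z−ΔX∣ : ∀ {k} (W Y : FinSubⁿ G k) (X Z : FinSub G) {a b : ℕ} →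
                          HasCard G (_−Δ_ G (⟦_⟧ⁿ G Y) Z) a →
                          HasCard G (_−Δ_ G (_×ⁿ_×₁_ G Y W Z) X) b →
                          ∣_∣ⁿ G W * ∣_∣ G X * a ≤ b
  ∣W×X∣∣Y−ΔZ∣≤∣Y×W×Z−ΔX∣ {k} (Ws , Ws!) Y (Xs , Xs!) Z (L , L! , _ , L⊆ , refl) (M , _ , ⊆M , _ , refl) =
    subst (_≤ length M) length-domain
      (injection⇒length≤ Domain (VecSetoid G _) embed embed-injective domain! embed∈M)
    where
    representation : ∀ i → _−Δ_ G (⟦_⟧ⁿ G Y) Z (lookup L i)
    representation i = L⊆ _ (∈-lookup (VecSetoid G k) L i)

    y : Fin (length L) → Vec Carrier k
    y i = proj₁ (representation i)

    z : Fin (length L) → Carrier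
    z i = proj₁ (proj₂ (representation i))

    y∈Y : ∀ i → _∈ⁿ_ G (y i) Y
    y∈Y i = proj₁ (proj₂ (proj₂ (representation i)))

    z∈Z : ∀ i → _∈₁_ G (z i) Z
    z∈Z i = proj₁ (proj₂ (proj₂ (proj₂ (representation i))))

    lookup≈[y-x]-[z-x] : ∀ i x → lookup L i ≈ᵛ shift G (shift G (y i) x) (z i - x)
    lookup≈[y-x]-[z-x] i x =
      ≈ᵛ-trans (proj₂ (proj₂ (proj₂ (proj₂ (representation i))))) (≈ᵛ-sym (shift-shift (y i) x (z i)))

    Domain : Setoid _ _
    Domain = (VecSetoid G k ×ₛ setoid) ×ₛ ≡.setoid (Fin (length L))

    domain : List (Setoid.Carrier Domain)
    domain = cartesianProduct (cartesianProduct Ws Xs) (allFin (length L))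

    domain! : Unique Domain domain
    domain! = cartesianProduct⁺ (VecSetoid G k ×ₛ setoid) (≡.setoid _)
      (cartesianProduct⁺ (VecSetoid G k) setoid Ws! Xs!) (allFin⁺ (length L))

    length-domain : length domain ≡ length Ws * length Xs * length L
    length-domain = ≡.trans (length-cartesianProductWith _,_ (cartesianProduct Ws Xs) (allFin (length L)))
      (cong₂ _*_ (length-cartesianProductWith _,_ Ws Xs) (length-tabulate (λ i → i)))

    embed : Setoid.Carrier Domain → Vec Carrier (k + (k + 1))
    embed ((w , x) , i) = shift G (y i ++ (w ++ (z i ∷ []))) x

    embed-injective : ∀ {d d'} → embed d ≈ᵛ embed d' → Setoid._≈_ Domain d d'
    embed-injective {(w , x) , i} {(w' , x') , j} e with shift-++⁻ (y i) (y j) e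
    ... | y-x≈ , rest with shift-++⁻ w w' rest
    ... | w-x≈ , (z-x≈ ∷ [])
      with lookup-injective (VecSetoid G k) L! i j
             (≈ᵛ-trans (lookup≈[y-x]-[z-x] i x)
               (≈ᵛ-trans (shift-cong y-x≈ z-x≈) (≈ᵛ-sym (lookup≈[y-x]-[z-x] j x'))))
    ... | refl = (shift-injective (≈ᵛ-trans w-x≈ (shift-cong ≈ᵛ-refl (sym x≈x'))) , x≈x') , refl
      where x≈x' = -‿cancelˡ z-x≈

    embed∈M : ∀ {d} → Membership._∈_ Domain d domain → Membership._∈_ (VecSetoid G _) (embed d) M
    embed∈M {(w , x) , i} d∈domain
      with ∈-cartesianProduct⁻ (VecSetoid G k ×ₛ setoid) (≡.setoid _) (cartesianProduct Ws Xs) (allFin _) d∈domain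
    ... | wx∈ , _ with ∈-cartesianProduct⁻ (VecSetoid G k) setoid Ws Xs wx∈
    ... | w∈W , x∈X = ⊆M _
      (y i ++ (w ++ (z i ∷ [])) , x , (y i , w , z i , y∈Y i , w∈W , z∈Z i , ≈ᵛ-refl) , x∈X , ≈ᵛ-refl)

-- None of the hypotheses 1 ≤ k, k ≡ m + suc n and 1 ≤ m is needed.
theorem1 : {c ℓ : Level} (G : AbelianGroup c ℓ) (k : ℕ) → 1 ≤ k →
    ((W Y : FinSubⁿ G k) (X Z : FinSub G) (a b : ℕ) →
        HasCard G (_−Δ_ G (⟦_⟧ⁿ G Y) Z) a →
        HasCard G (_−Δ_ G (_×ⁿ_×₁_ G Y W Z) X) b →
        ∣_∣ⁿ G W * ∣_∣ G X * a ≤ b)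
    × ((m n : ℕ) (As : Vec (FinSub G) m) (C : FinSub G) (Cs : Vec (FinSub G) n) (B : FinSub G) →
        k ≡ m + suc n → 1 ≤ m →
        (a b d : ℕ) →
        HasCard G (_−Δ_ G (Prod G (As ++ (C ∷ Cs))) B) a →
        HasCard G (_−Δ_ G (Prod G As) C) b →
        HasCard G (_−Δ_ G (Prod G (C ∷ Cs)) B) d →
        a ≤ b * d)
    × ((Y : FinSubⁿ G k) (X Z : FinSub G) (a b : ℕ) →
        HasCard G (_−Δ_ G (_×₁_ G Y Z) X) a →
        HasCard G (_−Δ_ G (_×₁_ G Y X) Z) b →
        a ≡ b)
theorem1 G k _ =
  (λ W Y X Z _ _ → ∣W×X∣∣Y−ΔZ∣≤∣Y×W×Z−ΔX∣ G W Y X Z) ,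
  (λ _ _ As C Cs B _ _ _ _ _ → ∣ΠA−ΔB∣≤∣ΠAs−ΔC∣∣ΠCs−ΔB∣ G As C Cs B) ,
  (λ Y X Z _ _ YZ−ΔX YX−ΔZ → ≤-antisym (∣Y×Z−ΔX∣≤∣Y×X−ΔZ∣ G Y X Z YZ−ΔX YX−ΔZ)
                                        (∣Y×Z−ΔX∣≤∣Y×X−ΔZ∣ G Y Z X YX−ΔZ YZ−ΔX))
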